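{- Let $k$ and $m$ be positive integers and let $t=\lceil\frac{m}{2}\rceil$. Let $G$ be a graph and $C\subseteq G$ a subgraph such that: (a) $\kappa(G)\geq k$; (b) $C$ is a complete graph of order $k$; (c) $G-V(C)$ is a bipartite graph and every vertex $u\in V(G)\setminus V(C)$ satisfies $d_G(u)\geq k+t$; (d) every pair of adjacent vertices in $V(G)\setminus V(C)$ have no common neighbor in $G$. Suppose moreover $\kappa(G)=k$. Let $S$ be a minimum vertex-cut of $G$ and let $F$ be a fragment of $G$ to $S$ such that $C\subseteq G[S\cup V(F)]$. If there exists a path $P$ of order at most $m$ in $G-(S\cup V(F))$ such that $\kappa(G\langle S\rangle-(V(F)\cup V(P)))\geq k$, then $\kappa(G-V(P))\geq k$.
   Context: All graphs are finite, simple and undirected. The connectivity $\kappa(G)$ is the minimum size of a vertex set $S$ such that $G-S$ is disconnected or has only one vertex. $d_G(u)$ is the degree of $u$ in $G$, and $G[X]$ is the subgraph induced by $X$. For $S\subseteq V(G)$, $G\langle S\rangle$ denotes the graph $G\cup K(S)$, i.e. $G$ with all edges between pairs of vertices of $S$ added. If $S$ is a minimum vertex-cut of $G$ (a vertex set of size $\kappa(G)$ whose removal disconnects $G$), a fragment of $G$ to $S$ is the union of at least one but not all components of $G-S$. The order of a path is its number of vertices. -}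

module Defs where

open import Data.Nat using (ℕ; suc; _≤_; _<_)
open import Data.Bool using (Bool; true; false; _∧_; _∨_; not; T)
open import Data.Bool.Properties using (∨-identityʳ; ∧-zeroʳ; ∧-comm; ∨-comm)
open import Data.Fin using (Fin; _≟_)
open import Data.Fin.Subset using (Subset; _∈_; _∉_; _⊆_; ∁; _∪_; _─_; ∣_∣; ⁅_⁆; ⊥; ⊤)
open import Data.Vec using (lookup; tabulate)
open import Data.List using (List; []; _∷_; foldr)
open import Data.Product using (_×_; Σ; _,_)
open import Data.Empty using () renaming (⊥ to Empty; ⊥-elim to ⊥-elim′)
open import Data.Unit using () renaming (⊤ to Unit)
open import Relation.Nullary using (¬_; does)
open import Relation.Nullary.Decidable using (dec-true)
open import Relation.Binary.PropositionalEquality using (_≡_; _≢_; refl; cong; cong₂; sym; trans)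

record Graph (n : ℕ) : Set where
  field
    adj    : Fin n → Fin n → Bool
    adj-sym    : ∀ u v → adj u v ≡ adj v u
    adj-irrefl : ∀ u → adj u u ≡ false
open Graph public

Adj : ∀ {n} → Graph n → Fin n → Fin n → Set
Adj G u v = T (adj G u v)

degree : ∀ {n} → Graph n → Fin n → ℕ
degree G u = ∣ tabulate (adj G u) ∣

-- walks inside a vertex set W (u ∈ W is required separately)
data Reach {n} (G : Graph n) (W : Subset n) (u : Fin n) : Fin n → Set where
  start : Reach G W u u
  step  : ∀ {v w} → Reach G W u v → Adj G v w → w ∈ W → Reach G W u w

Connected : ∀ {n} → Graph n → Subset n → Set
Connected G W = ∀ u v → u ∈ W → v ∈ W → Reach G W u v

κ≥ : ∀ {n} → Graph n → Subset n → ℕ → Set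
κ≥ G W k = ∀ X → X ⊆ W → ∣ X ∣ < k →
  Connected G (W ─ X) × (2 ≤ ∣ W ─ X ∣)

κ≡ : ∀ {n} → Graph n → Subset n → ℕ → Set
κ≡ G W k = κ≥ G W k × ¬ κ≥ G W (suc k)

MinVertexCut : ∀ {n} → Graph n → Subset n → Set
MinVertexCut G S = κ≡ G ⊤ ∣ S ∣ × ¬ Connected G (∁ S)

-- F is a fragment of G to S: a union of at least one but not all
-- components of G - S, i.e. a nonempty proper subset of V(G) \ S with no
-- edge of G between F and V(G) \ (S ∪ F).
Fragment : ∀ {n} → Graph n → Subset n → Subset n → Set
Fragment G S F =
  F ⊆ ∁ S ×
  Σ _ (λ x → x ∈ F) ×
  Σ _ (λ y → y ∈ ∁ (S ∪ F)) ×
  (∀ x y → x ∈ F → y ∈ ∁ (S ∪ F) → ¬ Adj G x y)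

IsClique : ∀ {n} → Graph n → Subset n → ℕ → Set
IsClique G K k = ∣ K ∣ ≡ k × (∀ u v → u ∈ K → v ∈ K → u ≢ v → Adj G u v)

BipartiteOutside : ∀ {n} → Graph n → Subset n → Set
BipartiteOutside G W = Σ (Fin _ → Bool) λ col →
  ∀ u v → u ∉ W → v ∉ W → Adj G u v → col u ≢ col v

vset : ∀ {n} → List (Fin n) → Subset n
vset = foldr (λ v s → ⁅ v ⁆ ∪ s) ⊥

Consecutive : ∀ {n} → Graph n → List (Fin n) → Set
Consecutive G []           = Unit
Consecutive G (x ∷ [])     = Unit
Consecutive G (x ∷ y ∷ r)  = Adj G x y × Consecutive G (y ∷ r)

Distinct : ∀ {n} → List (Fin n) → Set
Distinct []      = Unit
Distinct (x ∷ r) = x ∉ vset r × Distinct r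

PathIn : ∀ {n} → Graph n → Subset n → ℕ → List (Fin n) → Set
PathIn G W m []      = Empty
PathIn G W m (x ∷ r) =
  Distinct (x ∷ r) × Consecutive G (x ∷ r) × vset (x ∷ r) ⊆ W ×
  Data.List.length (x ∷ r) ≤ m

cliqueAdj : ∀ {n} → Subset n → Fin n → Fin n → Bool
cliqueAdj S u v = lookup S u ∧ lookup S v ∧ not (does (u ≟ v))

private
  ≟-sym : ∀ {n} (u v : Fin n) → does (u ≟ v) ≡ does (v ≟ u)
  ≟-sym u v with u ≟ v | v ≟ u
  ... | Relation.Nullary.yes _ | Relation.Nullary.yes _ = refl
  ... | Relation.Nullary.no _  | Relation.Nullary.no _  = refl
  ... | Relation.Nullary.yes p | Relation.Nullary.no q  = ⊥-elim′ (q (sym p))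
  ... | Relation.Nullary.no p  | Relation.Nullary.yes q = ⊥-elim′ (p (sym q))

  cliqueAdj-sym : ∀ {n} (S : Subset n) u v → cliqueAdj S u v ≡ cliqueAdj S v u
  cliqueAdj-sym S u v with lookup S u | lookup S v
  ... | true  | true  = cong not (≟-sym u v)
  ... | true  | false = refl
  ... | false | true  = refl
  ... | false | false = refl

  cliqueAdj-irr : ∀ {n} (S : Subset n) u → cliqueAdj S u u ≡ false
  cliqueAdj-irr S u rewrite dec-true (u ≟ u) refl = trans (cong (λ b → lookup S u ∧ b) (∧-zeroʳ (lookup S u))) (∧-zeroʳ (lookup S u))

_⟨_⟩ : ∀ {n} → Graph n → Subset n → Graph n
G ⟨ S ⟩ = record
  { adj    = λ u v → adj G u v ∨ cliqueAdj S u v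
  ; adj-sym    = λ u v → cong₂ _∨_ (adj-sym G u v) (cliqueAdj-sym S u v)
  ; adj-irrefl = λ u → trans (cong₂ _∨_ (adj-irrefl G u) (cliqueAdj-irr S u)) refl
  }

-- Fix X ⊆ V(G) − V(P) with |X| < k and let W be the rest of G − V(P); write F′ for
-- V(G) − S − F and V′ = V(G⟨S⟩) − F − V(P).  For a component K of G[W] put T = S ∩ K.
-- If K meets F, then (X ∩ (S ∪ F)) ∪ T separates K ∩ F from F′ in G, so it has at least
-- k vertices; if K meets F′ and S − X ⊄ K, then (X ∩ V′) ∪ T separates K ∩ F′ from S − K
-- in G⟨S⟩ − F − V(P), again forcing at least k vertices.  The two parts of X meet only in
-- X ∩ S, and the sets T of different components are disjoint subsets of S, so two different
-- components cannot carry one bound each.  The component of a vertex of C − X carries the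
-- first bound; any other component avoids C and hence leaves S (two adjacent vertices outside
-- C have disjoint neighbourhoods of size ≥ k once P is deleted), and either it or a component meeting
-- F′ − V(P) − X, which is nonempty because |F′ − V(P)| ≥ k, carries the second.

module Submission where

open import Defs
open import Data.Nat using (ℕ; zero; suc; _+_; _≤_; _<_; s≤s; ⌈_/2⌉)
open import Data.Nat.Properties hiding (_≟_)
open import Data.Bool using (true; false; T)
open import Data.Fin using (Fin; _≟_)
open import Data.Fin.Subset
open import Data.Fin.Subset.Properties
open import Data.Fin.Properties using (any?)
open import Data.Vec using ([]; _∷_; lookup; tabulate; here; there)
open import Data.Vec.Properties using (lookup∘tabulate; lookup⇒[]=; []=⇒lookup)
open import Data.List using (List; []; _∷_; length)
open import Data.Product using (_×_; _,_; proj₁; proj₂; ∃)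
open import Data.Sum using (_⊎_; inj₁; inj₂; [_,_]′)
open import Data.Empty using (⊥-elim)
open import Function using (_∘_)
open import Algebra.Properties.CommutativeSemigroup +-commutativeSemigroup using (interchange)
open import Relation.Nullary using (¬_; Dec; yes; no; does; contradiction)
open import Relation.Nullary.Decidable using (dec-true; map′; _×-dec_; ¬?)
open import Relation.Nullary.Decidable.Core using (T?)
open import Relation.Unary using (Decidable)
open import Relation.Binary.PropositionalEquality using (_≡_; refl; sym; trans; cong; subst; module ≡-Reasoning)

private
  variable
    n : ℕ
    p q : Subset n
    x : Fin n

⟦_⟧ : {P : Fin n → Set} → Decidable P → Subset n
⟦ P? ⟧ = tabulate (does ∘ P?)

∈⟦⟧⁺ : {P : Fin n → Set} (P? : Decidable P) → ∀ {x} → P x → x ∈ ⟦ P? ⟧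
∈⟦⟧⁺ P? {x} px = lookup⇒[]= x _ (trans (lookup∘tabulate _ x) (dec-true (P? x) px))

∈⟦⟧⁻ : {P : Fin n → Set} (P? : Decidable P) → ∀ {x} → x ∈ ⟦ P? ⟧ → P x
∈⟦⟧⁻ P? {x} x∈ with P? x in eq
... | yes px = px
... | no _ with () ← trans (sym ([]=⇒lookup x∈)) (trans (lookup∘tabulate _ x) (cong does eq))

x∈p─q⇒x∉q : x ∈ p ─ q → x ∉ q
x∈p─q⇒x∉q {p = _ ∷ p} {q = _ ∷ q} (there x∈) (there x∈q) = x∈p─q⇒x∉q x∈ x∈q
x∈p─q⇒x∉q {p = _ ∷ p} {q = _ ∷ q} () here

x∉p∪q : x ∉ p → x ∉ q → x ∉ p ∪ q
x∉p∪q {p = p} {q} x∉p x∉q x∈ = [ x∉p , x∉q ]′ (x∈p∪q⁻ p q x∈)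

⊈⇒∃∉ : ¬ (p ⊆ q) → ∃ λ x → x ∈ p × x ∉ q
⊈⇒∃∉ {p = p} {q} p⊈q with any? (λ x → (x ∈? p) ×-dec ¬? (x ∈? q))
... | yes w = w
... | no ∄ = ⊥-elim (p⊈q p⊆q)
  where
  p⊆q : p ⊆ q
  p⊆q {x} x∈p with x ∈? q
  ... | yes x∈q = x∈q
  ... | no x∉q = contradiction (x , x∈p , x∉q) ∄

∣p∣<∣q∣⇒∃∉ : ∣ p ∣ < ∣ q ∣ → ∃ λ x → x ∈ q × x ∉ p
∣p∣<∣q∣⇒∃∉ lt = ⊈⇒∃∉ (<⇒≱ lt ∘ p⊆q⇒∣p∣≤∣q∣)

∣p∪q∣+∣p∩q∣≡∣p∣+∣q∣ : ∀ (p q : Subset n) → ∣ p ∪ q ∣ + ∣ p ∩ q ∣ ≡ ∣ p ∣ + ∣ q ∣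
∣p∪q∣+∣p∩q∣≡∣p∣+∣q∣ [] [] = refl
∣p∪q∣+∣p∩q∣≡∣p∣+∣q∣ (true ∷ p) (true ∷ q) = cong suc (trans (+-suc ∣ p ∪ q ∣ ∣ p ∩ q ∣)
  (trans (cong suc (∣p∪q∣+∣p∩q∣≡∣p∣+∣q∣ p q)) (sym (+-suc ∣ p ∣ ∣ q ∣))))
∣p∪q∣+∣p∩q∣≡∣p∣+∣q∣ (true ∷ p) (false ∷ q) = cong suc (∣p∪q∣+∣p∩q∣≡∣p∣+∣q∣ p q)
∣p∪q∣+∣p∩q∣≡∣p∣+∣q∣ (false ∷ p) (true ∷ q) = trans (cong suc (∣p∪q∣+∣p∩q∣≡∣p∣+∣q∣ p q)) (sym (+-suc ∣ p ∣ ∣ q ∣))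
∣p∪q∣+∣p∩q∣≡∣p∣+∣q∣ (false ∷ p) (false ∷ q) = ∣p∪q∣+∣p∩q∣≡∣p∣+∣q∣ p q

∣p∪q∣≤∣p∣+∣q∣ : ∀ (p q : Subset n) → ∣ p ∪ q ∣ ≤ ∣ p ∣ + ∣ q ∣
∣p∪q∣≤∣p∣+∣q∣ p q = subst (∣ p ∪ q ∣ ≤_) (∣p∪q∣+∣p∩q∣≡∣p∣+∣q∣ p q) (m≤m+n _ _)

Empty⇒∣p∣≡0 : Empty p → ∣ p ∣ ≡ 0
Empty⇒∣p∣≡0 {n} e rewrite Empty-unique e = ∣⊥∣≡0 n

0<∣p∣⇒Nonempty : 0 < ∣ p ∣ → Nonempty p
0<∣p∣⇒Nonempty {p = p} 0<∣p∣ with nonempty? p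
... | yes ne = ne
... | no e = contradiction (Empty⇒∣p∣≡0 e) (>⇒≢ 0<∣p∣)

disjoint⇒∣p∪q∣≡∣p∣+∣q∣ : ∀ (p q : Subset n) → (∀ {x} → x ∈ p → x ∉ q) → ∣ p ∪ q ∣ ≡ ∣ p ∣ + ∣ q ∣
disjoint⇒∣p∪q∣≡∣p∣+∣q∣ p q disj = begin
  ∣ p ∪ q ∣                 ≡⟨ +-identityʳ _ ⟨
  ∣ p ∪ q ∣ + 0             ≡⟨ cong (∣ p ∪ q ∣ +_) (Empty⇒∣p∣≡0 p∩q-empty) ⟨
  ∣ p ∪ q ∣ + ∣ p ∩ q ∣     ≡⟨ ∣p∪q∣+∣p∩q∣≡∣p∣+∣q∣ p q ⟩
  ∣ p ∣ + ∣ q ∣             ∎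
  where
  open ≡-Reasoning
  p∩q-empty : Empty (p ∩ q)
  p∩q-empty (x , x∈) = let x∈p , x∈q = x∈p∩q⁻ p q x∈ in disj x∈p x∈q

-- chosen so that degree G z and ∣ neighbours G z ∣ are definitionally equal
neighbours : Graph n → Fin n → Subset n
neighbours G z = ⟦ T? ∘ adj G z ⟧

module _ (G : Graph n) where

  Adj-sym : ∀ {u v} → Adj G u v → Adj G v u
  Adj-sym {u} {v} = subst T (adj-sym G u v)

  ∈neighbours⁻ : ∀ {z y} → y ∈ neighbours G z → Adj G z y
  ∈neighbours⁻ {z} = ∈⟦⟧⁻ (T? ∘ adj G z)

  ⟨⟩-Adj-outside : ∀ {S u v} → u ∉ S → Adj (G ⟨ S ⟩) u v → Adj G u v
  ⟨⟩-Adj-outside {S} {u} {v} u∉S e with lookup S u in eq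
  ... | true = contradiction (lookup⇒[]= u S eq) u∉S
  ... | false with adj G u v
  ...   | true = _
  ...   | false = e

module _ (G : Graph n) (W : Subset n) where

  Reach-trans : ∀ {a b c} → Reach G W a b → Reach G W b c → Reach G W a c
  Reach-trans r start = r
  Reach-trans r (step r′ e c∈W) = step (Reach-trans r r′) e c∈W

  Reach-cons : ∀ {a b c} → Adj G a b → b ∈ W → Reach G W b c → Reach G W a c
  Reach-cons e b∈W start = step start e b∈W
  Reach-cons e b∈W (step r e′ c∈W) = step (Reach-cons e b∈W r) e′ c∈W

  Reach-∈ : ∀ {a b} → a ∈ W → Reach G W a b → b ∈ W
  Reach-∈ a∈W start = a∈W
  Reach-∈ a∈W (step _ _ b∈W) = b∈W

  Reach-sym : ∀ {a b} → a ∈ W → Reach G W a b → Reach G W b a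
  Reach-sym a∈W start = start
  Reach-sym a∈W (step r e _) = Reach-cons (Adj-sym G e) (Reach-∈ a∈W r) (Reach-sym a∈W r)

  Reach-preserves : (Z : Fin n → Set) → (∀ {v w} → Z v → Adj G v w → w ∈ W → Z w) →
                    ∀ {a b} → Reach G W a b → Z a → Z b
  Reach-preserves Z closed start za = za
  Reach-preserves Z closed (step r e w∈W) za = closed (Reach-preserves Z closed r za) e w∈W

  Frontier : Subset n → Fin n → Set
  Frontier R w = w ∈ W × ∃ λ v → v ∈ R × Adj G v w

  frontier? : ∀ R → Decidable (Frontier R)
  frontier? R w = (w ∈? W) ×-dec any? (λ v → (v ∈? R) ×-dec T? (adj G v w))

  frontier : Subset n → Subset n
  frontier R = ⟦ frontier? R ⟧

  frontier-mono : ∀ {R R′} → R ⊆ R′ → frontier R ⊆ frontier R′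
  frontier-mono {R} {R′} R⊆R′ w∈ with ∈⟦⟧⁻ (frontier? R) w∈
  ... | w∈W , v , v∈R , e = ∈⟦⟧⁺ (frontier? R′) (w∈W , v , R⊆R′ v∈R , e)

  ball : Fin n → ℕ → Subset n
  ball u zero = ⁅ u ⁆
  ball u (suc j) = ball u j ∪ frontier (ball u j)

  ∈ball⇒Reach : ∀ {u} j {w} → w ∈ ball u j → Reach G W u w
  ∈ball⇒Reach {u} zero w∈ rewrite x∈⁅y⁆⇒x≡y u w∈ = start
  ∈ball⇒Reach {u} (suc j) w∈ with x∈p∪q⁻ (ball u j) _ w∈
  ... | inj₁ w∈ball = ∈ball⇒Reach j w∈ball
  ... | inj₂ w∈frontier with ∈⟦⟧⁻ (frontier? (ball u j)) w∈frontier
  ...   | w∈W , v , v∈ball , e = step (∈ball⇒Reach j v∈ball) e w∈W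

  ball-closed-or-large : ∀ u j → frontier (ball u j) ⊆ ball u j ⊎ j < ∣ ball u j ∣
  ball-closed-or-large u zero = inj₂ (≤-reflexive (sym (∣⁅x⁆∣≡1 u)))
  ball-closed-or-large u (suc j) with frontier (ball u j) ⊆? ball u j | ball-closed-or-large u j
  ... | yes closed | _ = inj₁ (p⊆p∪q _ ∘ closed ∘ frontier-mono shrink)
    where
    shrink : ball u (suc j) ⊆ ball u j
    shrink w∈ = [ (λ w∈ball → w∈ball) , closed ]′ (x∈p∪q⁻ _ _ w∈)
  ... | no ¬closed | inj₁ closed = ⊥-elim (¬closed closed)
  ... | no ¬closed | inj₂ large with ⊈⇒∃∉ ¬closed
  ...   | w , w∈frontier , w∉ball = inj₂ (<-≤-trans (s≤s large)
          (p⊂q⇒∣p∣<∣q∣ (p⊆p∪q _ , w , q⊆p∪q _ _ w∈frontier , w∉ball)))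

  component : Fin n → Subset n
  component u = ball u n

  component-closed : ∀ u → frontier (component u) ⊆ component u
  component-closed u with ball-closed-or-large u n
  ... | inj₁ closed = closed
  ... | inj₂ large = contradiction (∣p∣≤n (component u)) (<⇒≱ large)

  Reach⇒∈component : ∀ {u w} → Reach G W u w → w ∈ component u
  Reach⇒∈component {u} start = ∈ball u n
    where
    ∈ball : ∀ u j → u ∈ ball u j
    ∈ball u zero = x∈⁅x⁆ u
    ∈ball u (suc j) = p⊆p∪q _ (∈ball u j)
  Reach⇒∈component {u} (step {v} r e w∈W) =
    component-closed u (∈⟦⟧⁺ (frontier? (component u)) (w∈W , v , Reach⇒∈component r , e))

  ∈component⇒Reach : ∀ {u w} → w ∈ component u → Reach G W u w
  ∈component⇒Reach = ∈ball⇒Reach n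

  reach? : ∀ u w → Dec (Reach G W u w)
  reach? u w = map′ ∈component⇒Reach Reach⇒∈component (w ∈? component u)

  IsClique⇒Reach : ∀ {C k c c′} → IsClique G C k → c ∈ C → c′ ∈ C → c′ ∈ W → Reach G W c c′
  IsClique⇒Reach {c = c} {c′} clique c∈C c′∈C c′∈W with c ≟ c′
  ... | yes refl = start
  ... | no c≢c′ = step start (proj₂ clique c c′ c∈C c′∈C c≢c′) c′∈W

κ≥⇒k≤∣separator∣ : ∀ {G : Graph n} {U Y k} (Z : Fin n → Set) → κ≥ G U k → Y ⊆ U →
                   (∀ {v w} → Z v → Adj G v w → w ∈ U ─ Y → Z w) →
                   ∀ {a b} → a ∈ U ─ Y → b ∈ U ─ Y → Z a → ¬ Z b → k ≤ ∣ Y ∣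
κ≥⇒k≤∣separator∣ {G = G} {U} {Y} Z κ Y⊆U closed a∈ b∈ za ¬zb = ≮⇒≥ λ ∣Y∣<k →
  ¬zb (Reach-preserves G (U ─ Y) Z closed (proj₁ (κ Y Y⊆U ∣Y∣<k) _ _ a∈ b∈) za)

κ≥⇒≤ : ∀ {G : Graph n} {W a b} → κ≥ G W a → κ≡ G W b → a ≤ b
κ≥⇒≤ κa (_ , ¬κ1+b) = ≮⇒≥ λ b<a → ¬κ1+b λ X X⊆W ∣X∣<1+b → κa X X⊆W (<-≤-trans ∣X∣<1+b b<a)

κ≡-functional : ∀ {G : Graph n} {W a b} → κ≡ G W a → κ≡ G W b → a ≡ b
κ≡-functional κa κb = ≤-antisym (κ≥⇒≤ (proj₁ κa) κb) (κ≥⇒≤ (proj₁ κb) κa)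

∣p∩⁅x⁆∪q∣≤1+∣p∩q∣ : ∀ (p q : Subset n) x → ∣ p ∩ (⁅ x ⁆ ∪ q) ∣ ≤ suc ∣ p ∩ q ∣
∣p∩⁅x⁆∪q∣≤1+∣p∩q∣ p q x = begin
  ∣ p ∩ (⁅ x ⁆ ∪ q) ∣   ≤⟨ p⊆q⇒∣p∣≤∣q∣ ⊆⁅x⁆∪p∩q ⟩
  ∣ ⁅ x ⁆ ∪ (p ∩ q) ∣   ≤⟨ ∣p∪q∣≤∣p∣+∣q∣ ⁅ x ⁆ (p ∩ q) ⟩
  ∣ ⁅ x ⁆ ∣ + ∣ p ∩ q ∣ ≡⟨ cong (_+ ∣ p ∩ q ∣) (∣⁅x⁆∣≡1 x) ⟩
  suc ∣ p ∩ q ∣         ∎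
  where
  open ≤-Reasoning
  ⊆⁅x⁆∪p∩q : p ∩ (⁅ x ⁆ ∪ q) ⊆ ⁅ x ⁆ ∪ (p ∩ q)
  ⊆⁅x⁆∪p∩q y∈ with x∈p∩q⁻ p _ y∈
  ... | y∈p , y∈⁅x⁆∪q = [ p⊆p∪q _ , (λ y∈q → q⊆p∪q _ _ (x∈p∩q⁺ (y∈p , y∈q))) ]′ (x∈p∪q⁻ ⁅ x ⁆ q y∈⁅x⁆∪q)

x∉p⇒∣p∩⁅x⁆∪q∣≤∣p∩q∣ : ∀ (p q : Subset n) {x} → x ∉ p → ∣ p ∩ (⁅ x ⁆ ∪ q) ∣ ≤ ∣ p ∩ q ∣
x∉p⇒∣p∩⁅x⁆∪q∣≤∣p∩q∣ p q {x} x∉p = p⊆q⇒∣p∣≤∣q∣ ⊆p∩q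
  where
  ⊆p∩q : p ∩ (⁅ x ⁆ ∪ q) ⊆ p ∩ q
  ⊆p∩q y∈ with x∈p∩q⁻ p _ y∈
  ... | y∈p , y∈⁅x⁆∪q with x∈p∪q⁻ ⁅ x ⁆ q y∈⁅x⁆∪q
  ...   | inj₁ y∈⁅x⁆ rewrite x∈⁅y⁆⇒x≡y x y∈⁅x⁆ = ⊥-elim (x∉p y∈p)
  ...   | inj₂ y∈q = x∈p∩q⁺ (y∈p , y∈q)

∣p∣≤∣p─q∣+∣p∩q∣ : ∀ (p q : Subset n) → ∣ p ∣ ≤ ∣ p ─ q ∣ + ∣ p ∩ q ∣
∣p∣≤∣p─q∣+∣p∩q∣ p q = ≤-trans (p⊆q⇒∣p∣≤∣q∣ split) (∣p∪q∣≤∣p∣+∣q∣ (p ─ q) (p ∩ q))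
  where
  split : p ⊆ (p ─ q) ∪ (p ∩ q)
  split {x} x∈p with x ∈? q
  ... | yes x∈q = q⊆p∪q _ _ (x∈p∩q⁺ (x∈p , x∈q))
  ... | no x∉q = p⊆p∪q _ (x∈p∧x∉q⇒x∈p─q x∈p x∉q)

Consecutive-tail : ∀ {G : Graph n} {a} l → Consecutive G (a ∷ l) → Consecutive G l
Consecutive-tail [] _ = _
Consecutive-tail (_ ∷ _) (_ , consecutive) = consecutive

∣neighbours∩vset∣≤⌈length/2⌉ : ∀ (G : Graph n) z (l : List (Fin n)) → Consecutive G l →
  (∀ {a b} → a ∈ vset l → b ∈ vset l → Adj G a b → Adj G z a → ¬ Adj G z b) →
  ∣ neighbours G z ∩ vset l ∣ ≤ ⌈ length l /2⌉
∣neighbours∩vset∣≤⌈length/2⌉ {n} G z [] _ _ = ≤-trans (∣p∩q∣≤∣q∣ (neighbours G z) ⊥) (≤-reflexive (∣⊥∣≡0 n))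
∣neighbours∩vset∣≤⌈length/2⌉ G z (a ∷ []) _ no-two =
  ≤-trans (∣p∩⁅x⁆∪q∣≤1+∣p∩q∣ (neighbours G z) _ a) (s≤s (∣neighbours∩vset∣≤⌈length/2⌉ G z [] _ (λ a∈ → ⊥-elim (∉⊥ a∈))))
∣neighbours∩vset∣≤⌈length/2⌉ G z (a ∷ b ∷ l) (a~b , consecutive) no-two =
  bound (T? (adj G z a))
    (∣neighbours∩vset∣≤⌈length/2⌉ G z l (Consecutive-tail l consecutive)
       (λ a∈ b∈ → no-two (q⊆p∪q _ _ (q⊆p∪q _ _ a∈)) (q⊆p∪q _ _ (q⊆p∪q _ _ b∈))))
    (∣neighbours∩vset∣≤⌈length/2⌉ G z (b ∷ l) consecutive
       (λ a∈ b∈ → no-two (q⊆p∪q _ _ a∈) (q⊆p∪q _ _ b∈)))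
  where
  Nz = neighbours G z
  bound : Dec (Adj G z a) → ∣ Nz ∩ vset l ∣ ≤ ⌈ length l /2⌉ → ∣ Nz ∩ vset (b ∷ l) ∣ ≤ ⌈ length (b ∷ l) /2⌉ →
          ∣ Nz ∩ vset (a ∷ b ∷ l) ∣ ≤ ⌈ length (a ∷ b ∷ l) /2⌉
  bound (yes z~a) bound-l _ = begin
    ∣ Nz ∩ vset (a ∷ b ∷ l) ∣ ≤⟨ ∣p∩⁅x⁆∪q∣≤1+∣p∩q∣ Nz _ a ⟩
    suc ∣ Nz ∩ vset (b ∷ l) ∣ ≤⟨ s≤s (x∉p⇒∣p∩⁅x⁆∪q∣≤∣p∩q∣ Nz (vset l) z≁b) ⟩
    suc ∣ Nz ∩ vset l ∣       ≤⟨ s≤s bound-l ⟩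
    suc ⌈ length l /2⌉        ∎
    where
    open ≤-Reasoning
    z≁b : b ∉ Nz
    z≁b = no-two (p⊆p∪q _ (x∈⁅x⁆ a)) (q⊆p∪q ⁅ a ⁆ _ (p⊆p∪q _ (x∈⁅x⁆ b))) a~b z~a ∘ ∈neighbours⁻ G
  bound (no z≁a) _ bound-b∷l = ≤-trans (x∉p⇒∣p∩⁅x⁆∪q∣≤∣p∩q∣ Nz _ (z≁a ∘ ∈neighbours⁻ G))
                                       (≤-trans bound-b∷l (⌈n/2⌉-mono (n≤1+n _)))

k≤∣neighbours─vset∣ : ∀ (G : Graph n) {k m z} (l : List (Fin n)) → Consecutive G l → length l ≤ m →
  (∀ {a b} → a ∈ vset l → b ∈ vset l → Adj G a b → Adj G z a → ¬ Adj G z b) →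
  k + ⌈ m /2⌉ ≤ degree G z → k ≤ ∣ neighbours G z ─ vset l ∣
k≤∣neighbours─vset∣ G {k} {m} {z} l consecutive length≤m no-two k+⌈m/2⌉≤deg = +-cancelʳ-≤ ⌈ m /2⌉ k _ (begin
  k + ⌈ m /2⌉                   ≤⟨ k+⌈m/2⌉≤deg ⟩
  ∣ Nz ∣                        ≤⟨ ∣p∣≤∣p─q∣+∣p∩q∣ Nz (vset l) ⟩
  ∣ Nz ─ vset l ∣ + ∣ Nz ∩ vset l ∣ ≤⟨ +-monoʳ-≤ ∣ Nz ─ vset l ∣ (≤-trans
                                       (∣neighbours∩vset∣≤⌈length/2⌉ G z l consecutive no-two) (⌈n/2⌉-mono length≤m)) ⟩
  ∣ Nz ─ vset l ∣ + ⌈ m /2⌉     ∎)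
  where
  open ≤-Reasoning
  Nz = neighbours G z

-- D plays the role of V(P); the last two hypotheses are what (c) leaves after deleting P.
module FragmentDeletion
  {n} (G : Graph n) (k : ℕ) (S F D C : Subset n) (0<k : 0 < k)
  (κ≥k : κ≥ G ⊤ k) (∣S∣≡k : ∣ S ∣ ≡ k) (fragment : Fragment G S F) (D⊆F′ : D ⊆ ∁ (S ∪ F))
  (κ⟨S⟩≥k : κ≥ (G ⟨ S ⟩) (∁ (F ∪ D)) k)
  (clique : IsClique G C k) (C⊆S∪F : C ⊆ S ∪ F)
  (triangle-free : ∀ u v w → u ∉ C → v ∉ C → Adj G u v → Adj G u w → ¬ Adj G v w)
  (k<degree : ∀ z → z ∉ C → k < degree G z)
  (k≤∣neighbours─D∣ : ∀ z → z ∉ C → k ≤ ∣ neighbours G z ─ D ∣)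
  where

  F′ : Subset n
  F′ = ∁ (S ∪ F)

  V′ : Subset n
  V′ = ∁ (F ∪ D)

  data Part (x : Fin n) : Set where
    inS  : x ∈ S → Part x
    inF  : x ∈ F → Part x
    inF′ : x ∈ F′ → Part x

  part : ∀ x → Part x
  part x with x ∈? S | x ∈? F
  ... | yes x∈S | _       = inS x∈S
  ... | no _    | yes x∈F = inF x∈F
  ... | no x∉S  | no x∉F  = inF′ (x∉p⇒x∈∁p (x∉p∪q x∉S x∉F))

  no-edge : ∀ {x y} → x ∈ F → y ∈ F′ → ¬ Adj G x y
  no-edge = proj₂ (proj₂ (proj₂ fragment)) _ _

  F⇒∉S : ∀ {x} → x ∈ F → x ∉ S
  F⇒∉S = x∈∁p⇒x∉p ∘ proj₁ fragment

  F′⇒∉S : ∀ {x} → x ∈ F′ → x ∉ S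
  F′⇒∉S x∈F′ = x∈∁p⇒x∉p x∈F′ ∘ p⊆p∪q F

  F′⇒∉F : ∀ {x} → x ∈ F′ → x ∉ F
  F′⇒∉F x∈F′ = x∈∁p⇒x∉p x∈F′ ∘ q⊆p∪q S F

  F′⇒∉C : ∀ {x} → x ∈ F′ → x ∉ C
  F′⇒∉C x∈F′ = x∈∁p⇒x∉p x∈F′ ∘ C⊆S∪F

  S⇒∉D : ∀ {x} → x ∈ S → x ∉ D
  S⇒∉D x∈S x∈D = F′⇒∉S (D⊆F′ x∈D) x∈S

  F⇒∉D : ∀ {x} → x ∈ F → x ∉ D
  F⇒∉D x∈F x∈D = F′⇒∉F (D⊆F′ x∈D) x∈F

  V′⇒∉F : ∀ {x} → x ∈ V′ → x ∉ F
  V′⇒∉F x∈V′ = x∈∁p⇒x∉p x∈V′ ∘ p⊆p∪q D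

  V′⇒∉D : ∀ {x} → x ∈ V′ → x ∉ D
  V′⇒∉D x∈V′ = x∈∁p⇒x∉p x∈V′ ∘ q⊆p∪q F D

  C⇒∉D : ∀ {x} → x ∈ C → x ∉ D
  C⇒∉D x∈C x∈D = F′⇒∉C (D⊆F′ x∈D) x∈C

  S⇒∈V′ : ∀ {x} → x ∈ S → x ∈ V′
  S⇒∈V′ x∈S = x∉p⇒x∈∁p (x∉p∪q (λ x∈F → F⇒∉S x∈F x∈S) (S⇒∉D x∈S))

  adjacent⇒k+k≤∣A∣ : ∀ {u v A} → u ∉ C → v ∉ C → Adj G u v →
                       neighbours G u ─ D ⊆ A → neighbours G v ─ D ⊆ A → k + k ≤ ∣ A ∣
  adjacent⇒k+k≤∣A∣ {u} {v} {A} u∉C v∉C u~v Nu⊆A Nv⊆A = begin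
    k + k           ≤⟨ +-mono-≤ (k≤∣neighbours─D∣ u u∉C) (k≤∣neighbours─D∣ v v∉C) ⟩
    ∣ Nu ∣ + ∣ Nv ∣ ≡⟨ disjoint⇒∣p∪q∣≡∣p∣+∣q∣ Nu Nv disjoint ⟨
    ∣ Nu ∪ Nv ∣     ≤⟨ p⊆q⇒∣p∣≤∣q∣ (λ w∈ → [ Nu⊆A , Nv⊆A ]′ (x∈p∪q⁻ Nu Nv w∈)) ⟩
    ∣ A ∣           ∎
    where
    open ≤-Reasoning
    Nu = neighbours G u ─ D
    Nv = neighbours G v ─ D
    disjoint : ∀ {w} → w ∈ Nu → w ∉ Nv
    disjoint w∈Nu w∈Nv = triangle-free u v _ u∉C v∉C u~v
      (∈neighbours⁻ G (p─q⊆p _ D w∈Nu)) (∈neighbours⁻ G (p─q⊆p _ D w∈Nv))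

  F′-neighbours : ∀ {z} → z ∈ F′ → neighbours G z ─ D ⊆ S ∪ (F′ ─ D)
  F′-neighbours z∈F′ {y} y∈ with part y
  ... | inS y∈S   = p⊆p∪q _ y∈S
  ... | inF y∈F   = ⊥-elim (no-edge y∈F z∈F′ (Adj-sym G (∈neighbours⁻ G (p─q⊆p _ D y∈))))
  ... | inF′ y∈F′ = q⊆p∪q S _ (x∈p∧x∉q⇒x∈p─q y∈F′ (x∈p─q⇒x∉q y∈))

  -- κ(G⟨S⟩ − F − D) ≥ k rules out V′ ⊆ S, since S is a clique of order k in G⟨S⟩.
  F′─D-nonempty : Nonempty (F′ ─ D)
  F′─D-nonempty = 0<∣p∣⇒Nonempty (≤-pred (begin
    2                           ≤⟨ proj₂ (κ⟨S⟩≥k (S - s) (S⇒∈V′ ∘ p─q⊆p S _) ∣S-s∣<k) ⟩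
    ∣ V′ ─ (S - s) ∣            ≤⟨ p⊆q⇒∣p∣≤∣q∣ ⊆s∪F′─D ⟩
    ∣ ⁅ s ⁆ ∪ (F′ ─ D) ∣        ≤⟨ ∣p∪q∣≤∣p∣+∣q∣ ⁅ s ⁆ _ ⟩
    ∣ ⁅ s ⁆ ∣ + ∣ F′ ─ D ∣      ≡⟨ cong (_+ ∣ F′ ─ D ∣) (∣⁅x⁆∣≡1 s) ⟩
    1 + ∣ F′ ─ D ∣              ∎))
    where
    open ≤-Reasoning
    s∈S : Nonempty S
    s∈S = 0<∣p∣⇒Nonempty (subst (0 <_) (sym ∣S∣≡k) 0<k)
    s = proj₁ s∈S
    ∣S-s∣<k : ∣ S - s ∣ < k
    ∣S-s∣<k = subst (∣ S - s ∣ <_) ∣S∣≡k (x∈p⇒∣p-x∣<∣p∣ {p = S} (proj₂ s∈S))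
    ⊆s∪F′─D : V′ ─ (S - s) ⊆ ⁅ s ⁆ ∪ (F′ ─ D)
    ⊆s∪F′─D {y} y∈ with part y
    ... | inF y∈F = ⊥-elim (V′⇒∉F (p─q⊆p V′ _ y∈) y∈F)
    ... | inF′ y∈F′ = q⊆p∪q _ _ (x∈p∧x∉q⇒x∈p─q y∈F′ (V′⇒∉D (p─q⊆p V′ _ y∈)))
    ... | inS y∈S with y ≟ s
    ...   | yes refl = p⊆p∪q _ (x∈⁅x⁆ s)
    ...   | no y≢s = ⊥-elim (x∈p─q⇒x∉q y∈ (x∈p∧x≢y⇒x∈p-y y∈S y≢s))

  k≤∣F′─D∣ : k ≤ ∣ F′ ─ D ∣
  k≤∣F′─D∣ = bound (any? (λ y → T? (adj G u y) ×-dec (y ∈? F′)))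
    where
    u = proj₁ F′─D-nonempty
    u∈F′ = p─q⊆p F′ D (proj₂ F′─D-nonempty)
    bound : Dec (∃ λ y → Adj G u y × y ∈ F′) → k ≤ ∣ F′ ─ D ∣
    bound (yes (y , u~y , y∈F′)) = +-cancelˡ-≤ k k _ (begin
      k + k                 ≤⟨ adjacent⇒k+k≤∣A∣ (F′⇒∉C u∈F′) (F′⇒∉C y∈F′) u~y
                                 (F′-neighbours u∈F′) (F′-neighbours y∈F′) ⟩
      ∣ S ∪ (F′ ─ D) ∣      ≤⟨ ∣p∪q∣≤∣p∣+∣q∣ S _ ⟩
      ∣ S ∣ + ∣ F′ ─ D ∣    ≡⟨ cong (_+ ∣ F′ ─ D ∣) ∣S∣≡k ⟩
      k + ∣ F′ ─ D ∣        ∎)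
      where open ≤-Reasoning
    bound (no ∄) = ⊥-elim (<⇒≱ (k<degree u (F′⇒∉C u∈F′))
                                (≤-trans (p⊆q⇒∣p∣≤∣q∣ neighbours⊆S) (≤-reflexive ∣S∣≡k)))
      where
      neighbours⊆S : neighbours G u ⊆ S
      neighbours⊆S {y} y∈ with part y
      ... | inS y∈S = y∈S
      ... | inF y∈F = ⊥-elim (no-edge y∈F u∈F′ (Adj-sym G (∈neighbours⁻ G y∈)))
      ... | inF′ y∈F′ = ⊥-elim (∄ (y , ∈neighbours⁻ G y∈ , y∈F′))

  module _ (X : Subset n) (∣X∣<k : ∣ X ∣ < k) where

    W : Subset n
    W = ∁ D ─ X

    ∈W : ∀ {x} → x ∉ D → x ∉ X → x ∈ W
    ∈W x∉D = x∈p∧x∉q⇒x∈p─q (x∉p⇒x∈∁p x∉D)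

    W⇒∉D : ∀ {x} → x ∈ W → x ∉ D
    W⇒∉D = x∈∁p⇒x∉p ∘ p─q⊆p (∁ D) X

    W⇒∉X : ∀ {x} → x ∈ W → x ∉ X
    W⇒∉X = x∈p─q⇒x∉q

    _⇝_ : Fin n → Fin n → Set
    x ⇝ y = Reach G W x y

    reachedS : Fin n → Subset n
    reachedS x = S ∩ component G W x

    ∈reachedS⁺ : ∀ {x s} → s ∈ S → x ⇝ s → s ∈ reachedS x
    ∈reachedS⁺ s∈S x⇝s = x∈p∩q⁺ (s∈S , Reach⇒∈component G W x⇝s)

    ∈reachedS⁻ : ∀ {x s} → s ∈ reachedS x → s ∈ S × x ⇝ s
    ∈reachedS⁻ s∈ = let s∈S , s∈K = x∈p∩q⁻ S _ s∈ in s∈S , ∈component⇒Reach G W s∈K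

    XF XV : Subset n
    XF = X ∩ (S ∪ F)
    XV = X ∩ V′

    ∉X∩A∪reachedS : ∀ {A x w} → w ∉ X → w ∉ reachedS x → w ∉ (X ∩ A) ∪ reachedS x
    ∉X∩A∪reachedS w∉X w∉R = x∉p∪q (w∉X ∘ p∩q⊆p X _) w∉R

    ∈A⇒∉X : ∀ {A B w} → w ∈ A → w ∉ (X ∩ A) ∪ B → w ∉ X
    ∈A⇒∉X w∈A w∉ w∈X = w∉ (p⊆p∪q _ (x∈p∩q⁺ (w∈X , w∈A)))

    -- XF ∪ reachedS x separates the F-vertices reachable from x from F′ in G.
    F-bound : ∀ {x b} → x ∈ W → b ∈ F → x ⇝ b → k ≤ ∣ XF ∣ + ∣ reachedS x ∣
    F-bound {x} {b} x∈W b∈F x⇝b = ≤-trans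
      (κ≥⇒k≤∣separator∣ Z κ≥k (λ _ → ∈⊤) closed
        (x∈p∧x∉q⇒x∈p─q ∈⊤ b∉Y) (x∈p∧x∉q⇒x∈p─q ∈⊤ f′∉Y) (x⇝b , b∈F) (F′⇒∉F f′∈F′ ∘ proj₂))
      (∣p∪q∣≤∣p∣+∣q∣ XF (reachedS x))
      where
      Y = XF ∪ reachedS x
      f′ = proj₁ (proj₁ (proj₂ (proj₂ fragment)))
      f′∈F′ = proj₂ (proj₁ (proj₂ (proj₂ fragment)))
      b∉Y : b ∉ Y
      b∉Y = ∉X∩A∪reachedS (W⇒∉X (Reach-∈ G W x∈W x⇝b)) (F⇒∉S b∈F ∘ proj₁ ∘ ∈reachedS⁻)
      f′∉Y : f′ ∉ Y
      f′∉Y = x∉p∪q (x∈∁p⇒x∉p f′∈F′ ∘ p∩q⊆q X _) (F′⇒∉S f′∈F′ ∘ proj₁ ∘ ∈reachedS⁻)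
      Z : Fin n → Set
      Z w = x ⇝ w × w ∈ F
      closed : ∀ {v w} → Z v → Adj G v w → w ∈ ⊤ ─ Y → Z w
      closed {w = w} (x⇝v , v∈F) v~w w∈ = from-part (part w)
        where
        w∉Y = x∈p─q⇒x∉q w∈
        from-part : Part w → Z w
        from-part (inS w∈S) = ⊥-elim (w∉Y (q⊆p∪q XF _ (∈reachedS⁺ w∈S
                                (step x⇝v v~w (∈W (S⇒∉D w∈S) (∈A⇒∉X (p⊆p∪q F w∈S) w∉Y))))))
        from-part (inF w∈F) = step x⇝v v~w (∈W (F⇒∉D w∈F) (∈A⇒∉X (q⊆p∪q S F w∈F) w∉Y)) , w∈F
        from-part (inF′ w∈F′) = ⊥-elim (no-edge v∈F w∈F′ v~w)

    -- XV ∪ reachedS x separates the F′-vertices reachable from x from s in G⟨S⟩ − (F ∪ D).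
    F′-bound : ∀ {x a s} → x ∈ W → a ∈ F′ → x ⇝ a → s ∈ S → s ∉ X → ¬ x ⇝ s →
               k ≤ ∣ XV ∣ + ∣ reachedS x ∣
    F′-bound {x} {a} {s} x∈W a∈F′ x⇝a s∈S s∉X x↛s = ≤-trans
      (κ≥⇒k≤∣separator∣ Z κ⟨S⟩≥k Y⊆V′ closed
        (x∈p∧x∉q⇒x∈p─q a∈V′ a∉Y) (x∈p∧x∉q⇒x∈p─q (S⇒∈V′ s∈S) s∉Y) (x⇝a , a∈F′) (λ (_ , s∈F′) → F′⇒∉S s∈F′ s∈S))
      (∣p∪q∣≤∣p∣+∣q∣ XV (reachedS x))
      where
      Y = XV ∪ reachedS x
      a∈W = Reach-∈ G W x∈W x⇝a
      a∈V′ = x∉p⇒x∈∁p (x∉p∪q (F′⇒∉F a∈F′) (W⇒∉D a∈W))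
      a∉Y : a ∉ Y
      a∉Y = ∉X∩A∪reachedS (W⇒∉X a∈W) (F′⇒∉S a∈F′ ∘ proj₁ ∘ ∈reachedS⁻)
      s∉Y : s ∉ Y
      s∉Y = ∉X∩A∪reachedS s∉X (x↛s ∘ proj₂ ∘ ∈reachedS⁻)
      Y⊆V′ : Y ⊆ V′
      Y⊆V′ w∈ = [ p∩q⊆q X V′ , S⇒∈V′ ∘ proj₁ ∘ ∈reachedS⁻ ]′ (x∈p∪q⁻ XV _ w∈)
      Z : Fin n → Set
      Z w = x ⇝ w × w ∈ F′
      closed : ∀ {v w} → Z v → Adj (G ⟨ S ⟩) v w → w ∈ V′ ─ Y → Z w
      closed {w = w} (x⇝v , v∈F′) v~w w∈ = from-part (part w)
        where
        w∉Y = x∈p─q⇒x∉q w∈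
        w∈V′ = p─q⊆p V′ _ w∈
        x⇝w : x ⇝ w
        x⇝w = step x⇝v (⟨⟩-Adj-outside G (F′⇒∉S v∈F′) v~w) (∈W (V′⇒∉D w∈V′) (∈A⇒∉X w∈V′ w∉Y))
        from-part : Part w → Z w
        from-part (inS w∈S) = ⊥-elim (w∉Y (q⊆p∪q XV _ (∈reachedS⁺ w∈S x⇝w)))
        from-part (inF w∈F) = ⊥-elim (V′⇒∉F w∈V′ w∈F)
        from-part (inF′ w∈F′) = x⇝w , w∈F′

    outside-X : ∀ A → ∣ A ∣ ≡ k → ∃ λ a → a ∈ A × a ∉ X
    outside-X A ∣A∣≡k = ∣p∣<∣q∣⇒∃∉ (subst (∣ X ∣ <_) (sym ∣A∣≡k) ∣X∣<k)

    ∣X∩S∣+∣reachedS∣+∣reachedS∣≤k : ∀ {x y} → x ∈ W → y ∈ W → ¬ x ⇝ y →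
      ∣ X ∩ S ∣ + (∣ reachedS x ∣ + ∣ reachedS y ∣) ≤ k
    ∣X∩S∣+∣reachedS∣+∣reachedS∣≤k {x} {y} x∈W y∈W x↛y = begin
      ∣ X ∩ S ∣ + (∣ Rx ∣ + ∣ Ry ∣) ≡⟨ cong (∣ X ∩ S ∣ +_) (disjoint⇒∣p∪q∣≡∣p∣+∣q∣ Rx Ry Rx∉Ry) ⟨
      ∣ X ∩ S ∣ + ∣ Rx ∪ Ry ∣       ≡⟨ disjoint⇒∣p∪q∣≡∣p∣+∣q∣ (X ∩ S) (Rx ∪ Ry) X∩S∉Rx∪Ry ⟨
      ∣ X ∩ S ∪ (Rx ∪ Ry) ∣         ≤⟨ p⊆q⇒∣p∣≤∣q∣ ⊆S ⟩
      ∣ S ∣                         ≡⟨ ∣S∣≡k ⟩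
      k                             ∎
      where
      open ≤-Reasoning
      Rx = reachedS x
      Ry = reachedS y
      Rx∉Ry : ∀ {s} → s ∈ Rx → s ∉ Ry
      Rx∉Ry s∈Rx s∈Ry = x↛y (Reach-trans G W (proj₂ (∈reachedS⁻ s∈Rx)) (Reach-sym G W y∈W (proj₂ (∈reachedS⁻ s∈Ry))))
      reachedS⇒∉X : ∀ {z s} → z ∈ W → s ∈ reachedS z → s ∉ X
      reachedS⇒∉X z∈W s∈ = W⇒∉X (Reach-∈ G W z∈W (proj₂ (∈reachedS⁻ s∈)))
      X∩S∉Rx∪Ry : ∀ {s} → s ∈ X ∩ S → s ∉ Rx ∪ Ry
      X∩S∉Rx∪Ry s∈X∩S = x∉p∪q (λ s∈Rx → reachedS⇒∉X x∈W s∈Rx (p∩q⊆p X S s∈X∩S))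
                                (λ s∈Ry → reachedS⇒∉X y∈W s∈Ry (p∩q⊆p X S s∈X∩S))
      ⊆S : X ∩ S ∪ (Rx ∪ Ry) ⊆ S
      ⊆S s∈ = [ p∩q⊆q X S , [ p∩q⊆p S _ , p∩q⊆p S _ ]′ ∘ x∈p∪q⁻ Rx Ry ]′ (x∈p∪q⁻ (X ∩ S) _ s∈)

    ∣XF∣+∣XV∣≤∣X∣+∣X∩S∣ : ∣ XF ∣ + ∣ XV ∣ ≤ ∣ X ∣ + ∣ X ∩ S ∣
    ∣XF∣+∣XV∣≤∣X∣+∣X∩S∣ = subst (_≤ ∣ X ∣ + ∣ X ∩ S ∣) (∣p∪q∣+∣p∩q∣≡∣p∣+∣q∣ XF XV)
      (+-mono-≤ (p⊆q⇒∣p∣≤∣q∣ XF∪XV⊆X) (p⊆q⇒∣p∣≤∣q∣ XF∩XV⊆X∩S))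
      where
      XF∪XV⊆X : XF ∪ XV ⊆ X
      XF∪XV⊆X w∈ = [ p∩q⊆p X _ , p∩q⊆p X _ ]′ (x∈p∪q⁻ XF XV w∈)
      XF∩XV⊆X∩S : XF ∩ XV ⊆ X ∩ S
      XF∩XV⊆X∩S w∈ with x∈p∩q⁻ XF XV w∈
      ... | w∈XF , w∈XV with x∈p∩q⁻ X _ w∈XF
      ...   | w∈X , w∈S∪F = x∈p∩q⁺ (w∈X , [ (λ w∈S → w∈S) , (λ w∈F → ⊥-elim (V′⇒∉F (p∩q⊆q X V′ w∈XV) w∈F)) ]′
                                            (x∈p∪q⁻ S F w∈S∪F))

    -- Summing the two bounds exceeds the 2k − 1 vertices available in X ∪ S.
    bounds⇒⇝ : ∀ {x y} → x ∈ W → y ∈ W → k ≤ ∣ XF ∣ + ∣ reachedS x ∣ → k ≤ ∣ XV ∣ + ∣ reachedS y ∣ → x ⇝ y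
    bounds⇒⇝ {x} {y} x∈W y∈W bound-x bound-y with reach? G W x y
    ... | yes x⇝y = x⇝y
    ... | no x↛y = ⊥-elim (<-irrefl refl (begin-strict
      k + k                                         ≤⟨ +-mono-≤ bound-x bound-y ⟩
      (∣ XF ∣ + ∣ Rx ∣) + (∣ XV ∣ + ∣ Ry ∣)         ≡⟨ interchange (∣ XF ∣) (∣ Rx ∣) (∣ XV ∣) (∣ Ry ∣) ⟩
      (∣ XF ∣ + ∣ XV ∣) + (∣ Rx ∣ + ∣ Ry ∣)         ≤⟨ +-monoˡ-≤ (∣ Rx ∣ + ∣ Ry ∣) ∣XF∣+∣XV∣≤∣X∣+∣X∩S∣ ⟩
      (∣ X ∣ + ∣ X ∩ S ∣) + (∣ Rx ∣ + ∣ Ry ∣)       ≡⟨ +-assoc (∣ X ∣) (∣ X ∩ S ∣) _ ⟩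
      ∣ X ∣ + (∣ X ∩ S ∣ + (∣ Rx ∣ + ∣ Ry ∣))       ≤⟨ +-monoʳ-≤ ∣ X ∣ (∣X∩S∣+∣reachedS∣+∣reachedS∣≤k x∈W y∈W x↛y) ⟩
      ∣ X ∣ + k                                     <⟨ +-monoˡ-< k ∣X∣<k ⟩
      k + k                                         ∎))
      where
      open ≤-Reasoning
      Rx = reachedS x
      Ry = reachedS y

    bound⇒reachedS-nonempty : ∀ {A x} → k ≤ ∣ X ∩ A ∣ + ∣ reachedS x ∣ → Nonempty (reachedS x)
    bound⇒reachedS-nonempty {A} {x} bound with nonempty? (reachedS x)
    ... | yes ne = ne
    ... | no ∅ = ⊥-elim (<⇒≱ ∣X∣<k (begin
      k                                ≤⟨ bound ⟩
      ∣ X ∩ A ∣ + ∣ reachedS x ∣       ≡⟨ cong (∣ X ∩ A ∣ +_) (Empty⇒∣p∣≡0 ∅) ⟩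
      ∣ X ∩ A ∣ + 0                    ≡⟨ +-identityʳ _ ⟩
      ∣ X ∩ A ∣                        ≤⟨ ∣p∩q∣≤∣p∣ X A ⟩
      ∣ X ∣                            ∎))
      where open ≤-Reasoning

    reaches-S : ∀ {x} → x ∈ W → ∃ λ s → s ∈ S × x ⇝ s
    reaches-S {x} x∈W with nonempty? (reachedS x)
    ... | yes (s , s∈) = s , ∈reachedS⁻ s∈
    ... | no ∅ with part x
    ...   | inS x∈S = ⊥-elim (∅ (x , ∈reachedS⁺ x∈S start))
    ...   | inF x∈F = ⊥-elim (∅ (bound⇒reachedS-nonempty (F-bound x∈W x∈F start)))
    ...   | inF′ x∈F′ with outside-X S ∣S∣≡k
    ...     | s , s∈S , s∉X = ⊥-elim (∅ (bound⇒reachedS-nonempty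
                                  (F′-bound x∈W x∈F′ start s∈S s∉X (∅ ∘ (s ,_) ∘ ∈reachedS⁺ s∈S))))

    C-bound : ∀ {c} → c ∈ C → c ∉ X → k ≤ ∣ XF ∣ + ∣ reachedS c ∣
    C-bound {c} c∈C c∉X with any? (λ b → (b ∈? F) ×-dec reach? G W c b)
    ... | yes (b , b∈F , c⇝b) = F-bound (∈W (C⇒∉D c∈C) c∉X) b∈F c⇝b
    ... | no ∄ = begin
      k                            ≡⟨ proj₁ clique ⟨
      ∣ C ∣                        ≤⟨ p⊆q⇒∣p∣≤∣q∣ C⊆XF∪reachedS ⟩
      ∣ XF ∪ reachedS c ∣          ≤⟨ ∣p∪q∣≤∣p∣+∣q∣ XF _ ⟩
      ∣ XF ∣ + ∣ reachedS c ∣      ∎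
      where
      open ≤-Reasoning
      C⊆XF∪reachedS : C ⊆ XF ∪ reachedS c
      C⊆XF∪reachedS {c′} c′∈C with c′ ∈? X
      ... | yes c′∈X = p⊆p∪q _ (x∈p∩q⁺ (c′∈X , C⊆S∪F c′∈C))
      ... | no c′∉X = [ (λ c′∈S → q⊆p∪q XF _ (∈reachedS⁺ c′∈S c⇝c′)) , (λ c′∈F → ⊥-elim (∄ (c′ , c′∈F , c⇝c′))) ]′
                        (x∈p∪q⁻ S F (C⊆S∪F c′∈C))
        where c⇝c′ = IsClique⇒Reach G W clique c∈C c′∈C (∈W (C⇒∉D c′∈C) c′∉X)

    -- A component inside S would contain two adjacent non-clique vertices whose
    -- neighbourhoods off D are disjoint and lie in X ∪ S, which has fewer than 2k vertices.
    escapes-S : ∀ {o} → o ∈ W → (∀ {y} → o ⇝ y → y ∉ C) → ∃ λ y → o ⇝ y × y ∉ S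
    escapes-S {o} o∈W avoids-C with any? (λ y → reach? G W o y ×-dec ¬? (y ∈? S))
    ... | yes found = found
    ... | no ∄ =
      let t , _ , o⇝t = reaches-S o∈W
          w , w∈N─D , w∉X = ∣p∣<∣q∣⇒∃∉ (<-≤-trans ∣X∣<k (k≤∣neighbours─D∣ t (avoids-C o⇝t)))
          t~w = ∈neighbours⁻ G (p─q⊆p _ D w∈N─D)
          o⇝w = step o⇝t t~w (∈W (x∈p─q⇒x∉q w∈N─D) w∉X)
      in ⊥-elim (<⇒≱ (+-mono-<-≤ ∣X∣<k (≤-reflexive ∣S∣≡k))
                     (≤-trans (adjacent⇒k+k≤∣A∣ (avoids-C o⇝t) (avoids-C o⇝w) t~w
                                 (neighbours⊆X∪S o⇝t) (neighbours⊆X∪S o⇝w))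
                              (∣p∪q∣≤∣p∣+∣q∣ X S)))
      where
      ⇝⇒∈S : ∀ {y} → o ⇝ y → y ∈ S
      ⇝⇒∈S {y} o⇝y with y ∈? S
      ... | yes y∈S = y∈S
      ... | no y∉S = ⊥-elim (∄ (y , o⇝y , y∉S))
      neighbours⊆X∪S : ∀ {z} → o ⇝ z → neighbours G z ─ D ⊆ X ∪ S
      neighbours⊆X∪S o⇝z {y} y∈ with y ∈? X
      ... | yes y∈X = p⊆p∪q S y∈X
      ... | no y∉X = q⊆p∪q X S (⇝⇒∈S (step o⇝z (∈neighbours⁻ G (p─q⊆p _ D y∈)) (∈W (x∈p─q⇒x∉q y∈) y∉X)))

    -- Otherwise the component of o, which avoids C, carries an F′-bound (pair it with the
    -- component of c) or an F-bound (pair it with a component meeting F′ − D − X).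
    reached-from-C : ∀ {c o} → c ∈ C → c ∈ W → o ∈ W → c ⇝ o
    reached-from-C {c} {o} c∈C c∈W o∈W with reach? G W c o
    ... | yes c⇝o = c⇝o
    ... | no c↛o = let y , o⇝y , y∉S = escapes-S o∈W avoids-C in from-part o⇝y y∉S (part y)
      where
      avoids-C : ∀ {y} → o ⇝ y → y ∉ C
      avoids-C o⇝y y∈C = c↛o (Reach-trans G W (IsClique⇒Reach G W clique c∈C y∈C (Reach-∈ G W o∈W o⇝y))
                                              (Reach-sym G W o∈W o⇝y))
      via-F′ : ∀ {a} → a ∈ F′ → o ⇝ a → c ⇝ o
      via-F′ a∈F′ o⇝a = let s , s∈S , c⇝s = reaches-S c∈W in
        bounds⇒⇝ c∈W o∈W (C-bound c∈C (W⇒∉X c∈W))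
          (F′-bound o∈W a∈F′ o⇝a s∈S (W⇒∉X (Reach-∈ G W c∈W c⇝s)) (c↛o ∘ Reach-trans G W c⇝s ∘ Reach-sym G W o∈W))
      via-F : ∀ {y a} → o ⇝ y → y ∈ F → a ∈ F′ → a ∈ W → Dec (o ⇝ a) → c ⇝ o
      via-F _ _ a∈F′ _ (yes o⇝a) = via-F′ a∈F′ o⇝a
      via-F o⇝y y∈F a∈F′ a∈W (no o↛a) = let t , t∈S , o⇝t = reaches-S o∈W in
        ⊥-elim (o↛a (bounds⇒⇝ o∈W a∈W (F-bound o∈W y∈F o⇝y)
          (F′-bound a∈W a∈F′ start t∈S (W⇒∉X (Reach-∈ G W o∈W o⇝t)) (o↛a ∘ Reach-trans G W o⇝t ∘ Reach-sym G W a∈W))))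
      from-part : ∀ {y} → o ⇝ y → y ∉ S → Part y → c ⇝ o
      from-part _ y∉S (inS y∈S) = ⊥-elim (y∉S y∈S)
      from-part o⇝y _ (inF′ y∈F′) = via-F′ y∈F′ o⇝y
      from-part o⇝y _ (inF y∈F) = let a , a∈F′─D , a∉X = ∣p∣<∣q∣⇒∃∉ (<-≤-trans ∣X∣<k k≤∣F′─D∣) in
        via-F o⇝y y∈F (p─q⊆p F′ D a∈F′─D) (∈W (x∈p─q⇒x∉q a∈F′─D) a∉X) (reach? G W o a)

    connected : Connected G W
    connected u v u∈W v∈W = let c , c∈C , c∉X = outside-X C (proj₁ clique)
                                c∈W = ∈W (C⇒∉D c∈C) c∉X
                            in Reach-trans G W (Reach-sym G W c∈W (reached-from-C c∈C c∈W u∈W))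
                                               (reached-from-C c∈C c∈W v∈W)

    two-vertices : 2 ≤ ∣ W ∣
    two-vertices = ≤-trans (proj₂ (κ⟨S⟩≥k XV (p∩q⊆q X V′) (≤-<-trans (∣p∩q∣≤∣p∣ X V′) ∣X∣<k)))
                           (p⊆q⇒∣p∣≤∣q∣ V′─XV⊆W)
      where
      V′─XV⊆W : V′ ─ XV ⊆ W
      V′─XV⊆W w∈ = ∈W (V′⇒∉D w∈V′) (λ w∈X → x∈p─q⇒x∉q w∈ (x∈p∩q⁺ (w∈X , w∈V′)))
        where w∈V′ = p─q⊆p V′ XV w∈

  κ≥-after-deletion : κ≥ G (∁ D) k
  κ≥-after-deletion X _ ∣X∣<k = connected X ∣X∣<k , two-vertices X ∣X∣<k

lemma2p4 : ∀ (k m : ℕ) → 0 < k → 0 < m →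
    ∀ {n} (G : Graph n) (C : Subset n) →
    κ≥ G ⊤ k →
    IsClique G C k →
    BipartiteOutside G C →
    (∀ u → u ∉ C → k + ⌈ m /2⌉ ≤ degree G u) →
    (∀ u v w → u ∉ C → v ∉ C → Adj G u v → Adj G u w → ¬ Adj G v w) →
    κ≡ G ⊤ k →
    ∀ (S F : Subset n) → MinVertexCut G S → Fragment G S F →
    C ⊆ (S ∪ F) →
    ∀ (P : List (Fin n)) → PathIn G (∁ (S ∪ F)) m P →
    κ≥ (G ⟨ S ⟩) (∁ (F ∪ vset P)) k →
    κ≥ G (∁ (vset P)) k
lemma2p4 k m 0<k 0<m G C κ≥k clique _ degree≥ triangle-free κ≡k S F minCut fragment C⊆S∪F
         P@(_ ∷ _) (_ , consecutive , P⊆F′ , length≤m) κ⟨S⟩≥k =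
  FragmentDeletion.κ≥-after-deletion G k S F (vset P) C 0<k κ≥k
    (κ≡-functional (proj₁ minCut) κ≡k) fragment P⊆F′ κ⟨S⟩≥k clique C⊆S∪F triangle-free
    (λ z z∉C → <-≤-trans (m<m+n k (⌈n/2⌉-mono 0<m)) (degree≥ z z∉C))
    (λ z z∉C → k≤∣neighbours─vset∣ G P consecutive length≤m (no-two z) (degree≥ z z∉C))
  where
  P∌C : ∀ {a} → a ∈ vset P → a ∉ C
  P∌C a∈P = x∈∁p⇒x∉p (P⊆F′ a∈P) ∘ C⊆S∪F
  no-two : ∀ z {a b} → a ∈ vset P → b ∈ vset P → Adj G a b → Adj G z a → ¬ Adj G z b
  no-two z a∈P b∈P a~b z~a z~b =
    triangle-free _ _ z (P∌C a∈P) (P∌C b∈P) a~b (Adj-sym G z~a) (Adj-sym G z~b)
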